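{- Let $n\geq0$. Then $\vDash_{\mathcal{R}_n^0}\circ^{n+2}\alpha$ for every formula $\alpha$.
   Context: Formulas are built from propositional variables using unary $\neg,\circ$ and binary $\land,\lor,\to$; $\circ^0\alpha=\alpha$, $\circ^{m+1}\alpha=\circ\circ^m\alpha$. $\mathcal{M}_0$ is the 3-valued Nmatrix (the Nmatrix of mbCciw) with domain $\{T,t,F\}$, designated set $D_0=\{T,t\}$, and multioperations: for $\#\in\{\land,\lor,\to\}$, $x\#y=\{T,t\}$ if the classical truth function $\#$ applied to ($x$ designated?, $y$ designated?) gives true, and $x\#y=\{F\}$ otherwise; $\neg T=\{F\}$, $\neg t=\neg F=\{T,t\}$; $\circ T=\circ F=\{T,t\}$, $\circ t=\{F\}$. A valuation over $\mathcal{M}_0$ is a map $\vartheta$ from formulas to $\{T,t,F\}$ with $\vartheta(\neg\alpha)\in\neg\vartheta(\alpha)$, $\vartheta(\circ\alpha)\in\circ\vartheta(\alpha)$, $\vartheta(\alpha\#\beta)\in\vartheta(\alpha)\#\vartheta(\beta)$. $\mathcal{F}_n^0$ is the set of valuations $\vartheta$ over $\mathcal{M}_0$ such that for every formula $\alpha$: if $\vartheta(\circ^n\alpha)\in\{T,F\}$ then $\vartheta(\circ^{n+1}\alpha)=T$. The RNmatrix $\mathcal{R}_n^0=\langle\mathcal{M}_0,\mathcal{F}_n^0\rangle$ has consequence relation: $\Gamma\vDash_{\mathcal{R}_n^0}\alpha$ iff for every $\vartheta\in\mathcal{F}_n^0$, $\vartheta[\Gamma]\subseteq D_0$ implies $\vartheta(\alpha)\in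 D_0$. -}

module Defs where

open import Data.Nat using (ℕ; zero; suc; _+_)
open import Data.Product using (_×_)
open import Data.Sum using (_⊎_)
open import Data.List using (List)
open import Data.List.Membership.Propositional using (_∈_)
open import Relation.Binary.PropositionalEquality using (_≡_)
open import Relation.Nullary using (¬_)

data Formula : Set where
  var  : ℕ → Formula
  ¬'_  : Formula → Formula
  ∘'_  : Formula → Formula
  _∧'_ : Formula → Formula → Formula
  _∨'_ : Formula → Formula → Formula
  _⇒'_ : Formula → Formula → Formula

∘^ : ℕ → Formula → Formula
∘^ zero    α = α
∘^ (suc m) α = ∘' (∘^ m α)

data V : Set where
  T t F : V

data Designated : V → Set where
  desT : Designated T
  dest : Designated t

-- multioperations, given as membership predicates  y ∈ op(x)
-- for binary connectives: x # y = {T,t} if classical # of designatedness is true, else {F}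
data NegM : V → V → Set where
  nT  : NegM T F
  ntT : NegM t T
  ntt : NegM t t
  nFT : NegM F T
  nFt : NegM F t

data CircM : V → V → Set where
  cTT : CircM T T
  cTt : CircM T t
  cFT : CircM F T
  cFt : CircM F t
  ctF : CircM t F

AndM : V → V → V → Set
AndM x y z = (Designated x × Designated y × Designated z)
           ⊎ (¬ (Designated x × Designated y) × z ≡ F)

OrM : V → V → V → Set
OrM x y z = ((Designated x ⊎ Designated y) × Designated z)
          ⊎ (¬ Designated x × ¬ Designated y × z ≡ F)

ImpM : V → V → V → Set
ImpM x y z = ((Designated x → Designated y) × Designated z)
           ⊎ (Designated x × ¬ Designated y × z ≡ F)

record Valuation : Set where
  field
    val   : Formula → V
    v-neg : ∀ α → NegM (val α) (val (¬' α))
    v-circ : ∀ α → CircM (val α) (val (∘' α))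
    v-and : ∀ α β → AndM (val α) (val β) (val (α ∧' β))
    v-or  : ∀ α β → OrM (val α) (val β) (val (α ∨' β))
    v-imp : ∀ α β → ImpM (val α) (val β) (val (α ⇒' β))
open Valuation public

InFn0 : ℕ → Valuation → Set
InFn0 n ϑ = ∀ α → (val ϑ (∘^ n α) ≡ T ⊎ val ϑ (∘^ n α) ≡ F) → val ϑ (∘^ (suc n) α) ≡ T

_⊨R[_]_ : List Formula → ℕ → Formula → Set
Γ ⊨R[ n ] α = (ϑ : Valuation) → InFn0 n ϑ → (∀ γ → γ ∈ Γ → Designated (val ϑ γ)) → Designated (val ϑ α)

-- Let x be the value of ∘ⁿα. If x is classical (T or F), the restriction defining
-- F_n^0 forces ∘ⁿ⁺¹α to take the value T; if x = t, then ∘ⁿ⁺¹α takes the value F.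
-- Either way ∘ⁿ⁺¹α is classical, and ∘ of a classical value is always designated.
{-# OPTIONS --safe #-}
module Submission where

open import Defs
open import Data.Nat using (ℕ; _+_)
open import Data.Nat.Properties using (+-comm)
open import Data.List using ([])
open import Data.Sum using (_⊎_; inj₁; inj₂)
open import Relation.Binary.PropositionalEquality using (_≡_; refl)

Classical : V → Set
Classical x = x ≡ T ⊎ x ≡ F

classical-or-t : (x : V) → Classical x ⊎ x ≡ t
classical-or-t T = inj₁ (inj₁ refl)
classical-or-t t = inj₂ refl
classical-or-t F = inj₁ (inj₂ refl)

CircM-classical-designated : ∀ {x y} → CircM x y → Classical x → Designated y
CircM-classical-designated cTT _ = desT
CircM-classical-designated cTt _ = dest
CircM-classical-designated cFT _ = desT
CircM-classical-designated cFt _ = dest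
CircM-classical-designated ctF (inj₁ ())
CircM-classical-designated ctF (inj₂ ())

CircM-t-F : ∀ {y} → CircM t y → y ≡ F
CircM-t-F ctF = refl

CircM²-designated : ∀ {x y z} → CircM x y → CircM y z → (Classical x → y ≡ T) →
                    Designated z
CircM²-designated {x} x∘y y∘z restricted with classical-or-t x
... | inj₁ x-classical = CircM-classical-designated y∘z (inj₁ (restricted x-classical))
... | inj₂ refl        = CircM-classical-designated y∘z (inj₂ (CircM-t-F x∘y))

theorem22 : (n : ℕ) (α : Formula) → [] ⊨R[ n ] ∘^ (n + 2) α
theorem22 n α ϑ ϑ∈Fn _ rewrite +-comm n 2 =
  CircM²-designated (v-circ ϑ (∘^ n α)) (v-circ ϑ (∘' ∘^ n α)) (ϑ∈Fn α)
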